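{- Let $(H,\omega)$ be an edge-weighted graph with positive integer weights and let $(G,\mathcal S)=(G(H,\omega),\mathcal S(H,\omega))$. Let $(A,B)$ be an $\mathcal S$-cut of $G$ and let $\{e_1,\dots,e_m\}$ be a semi-induced matching of $G$ between $A$ and $B$. Then at least $m-50$ of the edges $e_1,\dots,e_m$ are matching edges.
   Context: Construction of $(G(H,\omega),\mathcal S(H,\omega))$: for each ordered pair $(u,v)$ with $uv\in E(H)$, add an independent set $I(u,v)$ of $\omega(uv)$ new vertices; let $S(u)=\bigcup_{v\in N_H(u)}I(u,v)$ and $\mathcal S=\{S(u):u\in V(H)\}$. Dummy edges: for every two edges $uv,xy$ of $H$ sharing no endpoint, every vertex of $I(u,v)$ is joined to every vertex of $I(x,y)$ (for all orientations). Matching edges: for every $uv\in E(H)$, a perfect matching between $I(u,v)$ and $I(v,u)$. These are all the edges of $G$. An $\mathcal S$-cut is a bipartition $(A,B)$ of $V(G)$ such that each part of $\mathcal S$ lies in $A$ or in $B$. A semi-induced matching between $A$ and $B$ is a matching whose edges go between $A$ and $B$ and which is an induced matching of the bipartite graph formed by the edges of $G$ between $A$ and $B$. -}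

module Defs where

open import Data.Nat using (ℕ; _≤_; _∸_; _<_)
open import Data.Bool using (Bool; true; false)
open import Data.Fin using (Fin; toℕ)
open import Data.Fin.Subset using (Subset; ∣_∣; _∈_)
open import Data.Product using (Σ; _×_)
open import Data.Sum using (_⊎_)
open import Relation.Binary.PropositionalEquality using (_≡_; _≢_)
open import Relation.Nullary using (¬_)
open import Function.Definitions using (Injective)

-- A finite simple graph H on vertex set Fin n (symmetric, irreflexive
-- Boolean adjacency) with positive integer edge weights ω.
-- ω is only meaningful on edges; it must be symmetric (ω(uv) = ω(vu))
-- and positive there.
record WGraph : Set where
  field
    n          : ℕ
    adj        : Fin n → Fin n → Bool
    adj-sym    : ∀ u v → adj u v ≡ adj v u
    adj-irrefl : ∀ u → adj u u ≡ false
    ω          : Fin n → Fin n → ℕ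
    ω-sym      : ∀ u v → adj u v ≡ true → ω u v ≡ ω v u
    ω-pos      : ∀ u v → adj u v ≡ true → 1 ≤ ω u v

open WGraph public

-- Vertices of G(H,ω): the vertex (u,v,i) is the i-th element of I(u,v),
-- for an ordered pair (u,v) with uv ∈ E(H) and i < ω(uv).
record GV (H : WGraph) : Set where
  constructor gv
  field
    src  : Fin (n H)
    tgt  : Fin (n H)
    edge : adj H src tgt ≡ true
    idx  : Fin (ω H src tgt)

open GV public

DummyEdge : (H : WGraph) → GV H → GV H → Set
DummyEdge H x y =
  (src x ≢ src y) × (src x ≢ tgt y) × (tgt x ≢ src y) × (tgt x ≢ tgt y)

MatchingEdge : (H : WGraph) → GV H → GV H → Set
MatchingEdge H x y =
  (src y ≡ tgt x) × (tgt y ≡ src x) × (toℕ (idx x) ≡ toℕ (idx y))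

GAdj : (H : WGraph) → GV H → GV H → Set
GAdj H x y = DummyEdge H x y ⊎ MatchingEdge H x y

-- S(u) = ⋃_{v ∈ N(u)} I(u,v) = the vertices with src = u.
-- An S-cut (A,B) is given by side : V(G) → Bool (A = true, B = false)
-- such that each S(u) lies entirely on one side.
IsSCut : (H : WGraph) → (GV H → Bool) → Set
IsSCut H side = ∀ x y → src x ≡ src y → side x ≡ side y

-- A semi-induced matching {e_1,…,e_m} between A and B, e_k = a_k b_k
-- with a_k ∈ A, b_k ∈ B: a matching (a, b injective) of edges of G going
-- between A and B, induced in the bipartite graph of A–B edges
-- (no edge a_k b_l for k ≠ l).
record SemiInducedMatching (H : WGraph) (side : GV H → Bool) (m : ℕ) : Set where
  field
    a       : Fin m → GV H
    b       : Fin m → GV H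
    a-in-A  : ∀ k → side (a k) ≡ true
    b-in-B  : ∀ k → side (b k) ≡ false
    isEdge  : ∀ k → GAdj H (a k) (b k)
    a-inj   : Injective _≡_ _≡_ a
    b-inj   : Injective _≡_ _≡_ b
    induced : ∀ k l → k ≢ l → ¬ GAdj H (a k) (b l)

open SemiInducedMatching public

-- Record every vertex of G by its pair of H-endpoints: a vertex of I(u,v)
-- gets {u,v}.  A dummy edge joins two vertices with disjoint endpoint pairs,
-- while both ends of a matching edge carry the same pair.  So for a
-- semi-induced matching a_k b_k, the pair P_k of a_k meets the pair Q_l of b_l
-- whenever k ≠ l (a_k b_l is not a dummy edge), and P_k, Q_k are disjoint
-- exactly when a_k b_k is a dummy edge.  Fix a dummy index k₀.  Every other
-- dummy index l has P_l meeting Q_k₀ in some z and Q_l meeting P_k₀ in some w,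
-- and for fixed (z,w) there are at most two such l: for three of them, the
-- remaining endpoints of their pairs would coincide in a way that makes some
-- P_l meet Q_l.  Hence at most 1 + 4·2 = 9 of the edges are dummy edges.
module Submission where

open import Defs
open import Data.Bool using (Bool; true; false)
open import Data.Bool.Properties using (T-≡)
open import Data.Empty using (⊥; ⊥-elim)
open import Data.Fin using (Fin)
import Data.Fin as Fin
open import Data.Fin.Subset using (Subset; ∣_∣; _∈_; _∉_; ⁅_⁆; _∪_; _∩_; ∁; _⊆_)
open import Data.Fin.Subset.Properties
  using (nonempty?; Empty-unique; ∣⊥∣≡0; x∈⁅x⁆; ∣⁅x⁆∣≡1; x∉⁅y⁆⇒x≢y; x≢y⇒x∉⁅y⁆;
         x∈p∪q⁺; x∈p∩q⁺; x∈p∩q⁻; x∈∁p⇒x∉p; x∉p⇒x∈∁p; p⊆q⇒∣p∣≤∣q∣; ∣∁p∣≡n∸∣p∣)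
open import Data.Nat using (ℕ; _≤_; _∸_; _+_; z≤n; s≤s)
open import Data.Nat.Properties
  using (≤-trans; ≤-reflexive; +-mono-≤; +-monoʳ-≤; +-suc; n≤1+n; m≤m+n; ∸-monoʳ-≤;
         module ≤-Reasoning)
open import Data.Product using (Σ; _×_; _,_; proj₁; proj₂; ∃-syntax)
open import Data.Sum using (_⊎_; inj₁; inj₂)
open import Data.Vec using ([]; _∷_; lookup; tabulate)
open import Data.Vec.Properties using (lookup∘tabulate; lookup⇒[]=; []=⇒lookup)
open import Function using (_∘_; Equivalence)
open import Level using (Level)
open import Relation.Binary.Definitions using (DecidableEquality)
open import Relation.Binary.PropositionalEquality
  using (_≡_; _≢_; ≢-sym; refl; sym; trans; subst; module ≡-Reasoning)
open import Relation.Nullary using (¬_; Dec; yes; no; does)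
open import Relation.Nullary.Decidable
  using (isYes; isYes≗does; dec-true; toWitness; decidable-stable; ¬?; _×-dec_; _⊎-dec_)
open import Relation.Unary using (Pred; Decidable)

∣p∪q∣≤∣p∣+∣q∣ : ∀ {n} (p q : Subset n) → ∣ p ∪ q ∣ ≤ ∣ p ∣ + ∣ q ∣
∣p∪q∣≤∣p∣+∣q∣ []          []          = z≤n
∣p∪q∣≤∣p∣+∣q∣ (true ∷ p)  (true ∷ q)  =
  s≤s (≤-trans (∣p∪q∣≤∣p∣+∣q∣ p q) (+-monoʳ-≤ ∣ p ∣ (n≤1+n ∣ q ∣)))
∣p∪q∣≤∣p∣+∣q∣ (true ∷ p)  (false ∷ q) = s≤s (∣p∪q∣≤∣p∣+∣q∣ p q)
∣p∪q∣≤∣p∣+∣q∣ (false ∷ p) (true ∷ q)  rewrite +-suc ∣ p ∣ ∣ q ∣ = s≤s (∣p∪q∣≤∣p∣+∣q∣ p q)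
∣p∪q∣≤∣p∣+∣q∣ (false ∷ p) (false ∷ q) = ∣p∪q∣≤∣p∣+∣q∣ p q

module _ {n : ℕ} where

  satisfying : {ℓ : Level} {P : Pred (Fin n) ℓ} → Decidable P → Subset n
  satisfying P? = tabulate (does ∘ P?)

  ∈-satisfying⁺ : {ℓ : Level} {P : Pred (Fin n) ℓ} (P? : Decidable P) {x : Fin n} →
                  P x → x ∈ satisfying P?
  ∈-satisfying⁺ P? {x} px =
    lookup⇒[]= x _ (trans (lookup∘tabulate (does ∘ P?) x) (dec-true (P? x) px))

  ∈-satisfying⁻ : {ℓ : Level} {P : Pred (Fin n) ℓ} (P? : Decidable P) {x : Fin n} →
                  x ∈ satisfying P? → P x
  ∈-satisfying⁻ P? {x} x∈ = toWitness {a? = P? x}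
    (Equivalence.from T-≡ (begin
      isYes (P? x)                     ≡⟨ isYes≗does (P? x) ⟩
      does (P? x)                      ≡⟨ lookup∘tabulate (does ∘ P?) x ⟨
      lookup (satisfying P?) x         ≡⟨ []=⇒lookup x∈ ⟩
      true                             ∎))
    where open ≡-Reasoning

  ∣p∪q∣≤i+j : (p q : Subset n) {i j : ℕ} → ∣ p ∣ ≤ i → ∣ q ∣ ≤ j → ∣ p ∪ q ∣ ≤ i + j
  ∣p∪q∣≤i+j p q p≤i q≤j = ≤-trans (∣p∪q∣≤∣p∣+∣q∣ p q) (+-mono-≤ p≤i q≤j)

  ∣p∣≤-from-member : {p : Subset n} {k : ℕ} → (∀ {x} → x ∈ p → ∣ p ∣ ≤ k) → ∣ p ∣ ≤ k
  ∣p∣≤-from-member {p} bound with nonempty? p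
  ... | yes (x , x∈p) = bound x∈p
  ... | no empty rewrite Empty-unique empty | ∣⊥∣≡0 n = z≤n

  ∣p∣≤1 : {p : Subset n} → (∀ {x y} → x ∈ p → y ∈ p → x ≡ y) → ∣ p ∣ ≤ 1
  ∣p∣≤1 {p} unique = ∣p∣≤-from-member λ {x} x∈p →
    ≤-trans (p⊆q⇒∣p∣≤∣q∣ (λ y∈p → subst (_∈ ⁅ x ⁆) (unique x∈p y∈p) (x∈⁅x⁆ x)))
            (≤-reflexive (∣⁅x⁆∣≡1 x))

  ∣p∣≤2 : {p : Subset n} →
    (∀ {x y z} → x ∈ p → y ∈ p → z ∈ p → x ≢ y → x ≢ z → y ≢ z → ⊥) → ∣ p ∣ ≤ 2
  ∣p∣≤2 {p} noThree = ∣p∣≤-from-member bound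
    where
    bound : ∀ {x} → x ∈ p → ∣ p ∣ ≤ 2
    bound {x} x∈p = ≤-trans (p⊆q⇒∣p∣≤∣q∣ p⊆x∪rest)
                            (∣p∪q∣≤i+j ⁅ x ⁆ rest (≤-reflexive (∣⁅x⁆∣≡1 x)) rest≤1)
      where
      rest : Subset n
      rest = p ∩ ∁ ⁅ x ⁆

      ≢x : ∀ {y} → y ∈ rest → x ≢ y
      ≢x y∈rest = x∉⁅y⁆⇒x≢y (x∈∁p⇒x∉p (proj₂ (x∈p∩q⁻ p _ y∈rest))) ∘ sym

      p⊆x∪rest : p ⊆ ⁅ x ⁆ ∪ rest
      p⊆x∪rest {y} y∈p with y Fin.≟ x
      ... | yes refl = x∈p∪q⁺ (inj₁ (x∈⁅x⁆ x))
      ... | no y≢x   = x∈p∪q⁺ (inj₂ (x∈p∩q⁺ (y∈p , x∉p⇒x∈∁p (x≢y⇒x∉⁅y⁆ y≢x))))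

      rest≤1 : ∣ rest ∣ ≤ 1
      rest≤1 = ∣p∣≤1 λ {y} {z} y∈rest z∈rest → decidable-stable (y Fin.≟ z) λ y≢z →
        noThree x∈p (proj₁ (x∈p∩q⁻ p _ y∈rest)) (proj₁ (x∈p∩q⁻ p _ z∈rest))
                (≢x y∈rest) (≢x z∈rest) y≢z

module _ {V : Set} where

  infix 4 _∈₂_

  _∈₂_ : V → V × V → Set
  z ∈₂ (x , y) = z ≡ x ⊎ z ≡ y

  Meets : V × V → V × V → Set
  Meets e f = ∃[ z ] z ∈₂ e × z ∈₂ f

  ¬Meets⇒≢ : {e f : V × V} {x y : V} → ¬ Meets e f → x ∈₂ e → y ∈₂ f → x ≢ y
  ¬Meets⇒≢ ¬meets x∈e y∈f refl = ¬meets (_ , x∈e , y∈f)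

  ∈₂-other-unique : {e : V × V} {α z w : V} →
    α ∈₂ e → z ∈₂ e → w ∈₂ e → z ≢ α → w ≢ α → z ≡ w
  ∈₂-other-unique (inj₁ refl) (inj₁ refl) _           z≢α _   = ⊥-elim (z≢α refl)
  ∈₂-other-unique (inj₁ refl) (inj₂ refl) (inj₁ refl) _   w≢α = ⊥-elim (w≢α refl)
  ∈₂-other-unique (inj₁ refl) (inj₂ refl) (inj₂ refl) _   _   = refl
  ∈₂-other-unique (inj₂ refl) (inj₂ refl) _           z≢α _   = ⊥-elim (z≢α refl)
  ∈₂-other-unique (inj₂ refl) (inj₁ refl) (inj₂ refl) _   w≢α = ⊥-elim (w≢α refl)
  ∈₂-other-unique (inj₂ refl) (inj₁ refl) (inj₁ refl) _   _   = refl

  ∈₂? : DecidableEquality V → (z : V) (e : V × V) → Dec (z ∈₂ e)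
  ∈₂? _≟_ z (x , y) = (z ≟ x) ⊎-dec (z ≟ y)

  meets? : DecidableEquality V → (e f : V × V) → Dec (Meets e f)
  meets? _≟_ (x , y) (u , v) with x ≟ u | x ≟ v | y ≟ u | y ≟ v
  ... | yes x≡u | _       | _       | _       = yes (x , inj₁ refl , inj₁ x≡u)
  ... | no _    | yes x≡v | _       | _       = yes (x , inj₁ refl , inj₂ x≡v)
  ... | no _    | no _    | yes y≡u | _       = yes (y , inj₂ refl , inj₁ y≡u)
  ... | no _    | no _    | no _    | yes y≡v = yes (y , inj₂ refl , inj₂ y≡v)
  ... | no x≢u  | no x≢v  | no y≢u  | no y≢v  = no λ where
    (_ , inj₁ refl , inj₁ refl) → x≢u refl
    (_ , inj₁ refl , inj₂ refl) → x≢v refl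
    (_ , inj₂ refl , inj₁ refl) → y≢u refl
    (_ , inj₂ refl , inj₂ refl) → y≢v refl

module CrossIntersecting
  {V : Set} (_≟_ : DecidableEquality V) {m : ℕ} (P Q : Fin m → V × V)
  (cross : ∀ {k l} → k ≢ l → Meets (P k) (Q l)) where

  Apart : Fin m → Set
  Apart k = ¬ Meets (P k) (Q k)

  apart? : Decidable Apart
  apart? k = ¬? (meets? _≟_ (P k) (Q k))

  apart : Subset m
  apart = satisfying apart?

  Class : V → V → Fin m → Set
  Class α β l = Apart l × α ∈₂ P l × β ∈₂ Q l

  class? : ∀ α β → Decidable (Class α β)
  class? α β l = apart? l ×-dec ∈₂? _≟_ α (P l) ×-dec ∈₂? _≟_ β (Q l)

  class : V → V → Subset m
  class α β = satisfying (class? α β)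

  -- A point where Pᵢ meets Qⱼ is both the endpoint of Pᵢ other than α and the
  -- endpoint of Qⱼ other than β; comparing three such points makes Pₖ meet Qₖ.
  class-no-three : ∀ {α β i j k} → Class α β i → Class α β j → Class α β k →
    i ≢ j → i ≢ k → j ≢ k → ⊥
  class-no-three (apartᵢ , αᵢ , βᵢ) (apartⱼ , αⱼ , βⱼ) (apartₖ , αₖ , βₖ) i≢j i≢k j≢k
    with cross i≢j | cross i≢k | cross (j≢k ∘ sym)
  ... | wᵢⱼ , wᵢⱼ∈Pᵢ , wᵢⱼ∈Qⱼ | wᵢₖ , wᵢₖ∈Pᵢ , wᵢₖ∈Qₖ | wₖⱼ , wₖⱼ∈Pₖ , wₖⱼ∈Qⱼ =
    ¬Meets⇒≢ apartₖ wₖⱼ∈Pₖ wᵢₖ∈Qₖ (trans (sym via-Qⱼ) via-Pᵢ)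
    where
    via-Pᵢ : wᵢⱼ ≡ wᵢₖ
    via-Pᵢ = ∈₂-other-unique αᵢ wᵢⱼ∈Pᵢ wᵢₖ∈Pᵢ
      (≢-sym (¬Meets⇒≢ apartⱼ αⱼ wᵢⱼ∈Qⱼ)) (≢-sym (¬Meets⇒≢ apartₖ αₖ wᵢₖ∈Qₖ))

    via-Qⱼ : wᵢⱼ ≡ wₖⱼ
    via-Qⱼ = ∈₂-other-unique βⱼ wᵢⱼ∈Qⱼ wₖⱼ∈Qⱼ
      (¬Meets⇒≢ apartᵢ wᵢⱼ∈Pᵢ βᵢ) (¬Meets⇒≢ apartₖ wₖⱼ∈Pₖ βₖ)

  ∣class∣≤2 : ∀ α β → ∣ class α β ∣ ≤ 2
  ∣class∣≤2 α β = ∣p∣≤2 λ i∈ j∈ k∈ →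
    class-no-three (∈-satisfying⁻ (class? α β) i∈) (∈-satisfying⁻ (class? α β) j∈)
                   (∈-satisfying⁻ (class? α β) k∈)

  classes : V × V → V × V → Subset m
  classes (x , y) (u , v) = class x u ∪ class x v ∪ class y u ∪ class y v

  ∈-classes : ∀ {e f z w l} → z ∈₂ e → w ∈₂ f → l ∈ class z w → l ∈ classes e f
  ∈-classes (inj₁ refl) (inj₁ refl) l∈ = x∈p∪q⁺ (inj₁ l∈)
  ∈-classes (inj₁ refl) (inj₂ refl) l∈ = x∈p∪q⁺ (inj₂ (x∈p∪q⁺ (inj₁ l∈)))
  ∈-classes (inj₂ refl) (inj₁ refl) l∈ = x∈p∪q⁺ (inj₂ (x∈p∪q⁺ (inj₂ (x∈p∪q⁺ (inj₁ l∈)))))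
  ∈-classes (inj₂ refl) (inj₂ refl) l∈ = x∈p∪q⁺ (inj₂ (x∈p∪q⁺ (inj₂ (x∈p∪q⁺ (inj₂ l∈)))))

  ∣classes∣≤8 : ∀ e f → ∣ classes e f ∣ ≤ 8
  ∣classes∣≤8 (x , y) (u , v) =
    ∣p∪q∣≤i+j (class x u) _ (∣class∣≤2 x u) (∣p∪q∣≤i+j (class x v) _ (∣class∣≤2 x v)
      (∣p∪q∣≤i+j (class y u) _ (∣class∣≤2 y u) (∣class∣≤2 y v)))

  apart⊆⁅k⁆∪classes : ∀ k → apart ⊆ ⁅ k ⁆ ∪ classes (Q k) (P k)
  apart⊆⁅k⁆∪classes k {l} l∈apart with l Fin.≟ k
  ... | yes refl = x∈p∪q⁺ (inj₁ (x∈⁅x⁆ l))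
  ... | no l≢k with cross l≢k | cross (l≢k ∘ sym)
  ...   | z , z∈Pₗ , z∈Qₖ | w , w∈Pₖ , w∈Qₗ = x∈p∪q⁺ (inj₂ (∈-classes z∈Qₖ w∈Pₖ
          (∈-satisfying⁺ (class? _ _) (∈-satisfying⁻ apart? l∈apart , z∈Pₗ , w∈Qₗ))))

  ∉apart⇒meets : ∀ {k} → k ∉ apart → Meets (P k) (Q k)
  ∉apart⇒meets {k} k∉apart =
    decidable-stable (meets? _≟_ (P k) (Q k)) (k∉apart ∘ ∈-satisfying⁺ apart?)

  ∣apart∣≤9 : ∣ apart ∣ ≤ 9
  ∣apart∣≤9 = ∣p∣≤-from-member {p = apart} λ {k} _ →
    ≤-trans (p⊆q⇒∣p∣≤∣q∣ (apart⊆⁅k⁆∪classes k))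
            (∣p∪q∣≤i+j ⁅ k ⁆ _ (≤-reflexive (∣⁅x⁆∣≡1 k)) (∣classes∣≤8 (Q k) (P k)))

module _ {H : WGraph} where

  ends : GV H → Fin (n H) × Fin (n H)
  ends x = src x , tgt x

  dummy⇒¬meets : ∀ {x y} → DummyEdge H x y → ¬ Meets (ends x) (ends y)
  dummy⇒¬meets (≢₁ , _  , _  , _ ) (_ , inj₁ refl , inj₁ e) = ≢₁ e
  dummy⇒¬meets (_  , ≢₂ , _  , _ ) (_ , inj₁ refl , inj₂ e) = ≢₂ e
  dummy⇒¬meets (_  , _  , ≢₃ , _ ) (_ , inj₂ refl , inj₁ e) = ≢₃ e
  dummy⇒¬meets (_  , _  , _  , ≢₄) (_ , inj₂ refl , inj₂ e) = ≢₄ e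

  ¬meets⇒dummy : ∀ {x y} → ¬ Meets (ends x) (ends y) → DummyEdge H x y
  ¬meets⇒dummy ¬meets =
    ¬Meets⇒≢ ¬meets (inj₁ refl) (inj₁ refl) , ¬Meets⇒≢ ¬meets (inj₁ refl) (inj₂ refl) ,
    ¬Meets⇒≢ ¬meets (inj₂ refl) (inj₁ refl) , ¬Meets⇒≢ ¬meets (inj₂ refl) (inj₂ refl)

  ¬dummy⇒meets : ∀ {x y} → ¬ DummyEdge H x y → Meets (ends x) (ends y)
  ¬dummy⇒meets {x} {y} ¬dummy =
    decidable-stable (meets? Fin._≟_ _ _) (¬dummy ∘ ¬meets⇒dummy {x} {y})

  meets⇒matching : ∀ {x y} → GAdj H x y → Meets (ends x) (ends y) → MatchingEdge H x y
  meets⇒matching {x} {y} (inj₁ dummy) meets = ⊥-elim (dummy⇒¬meets {x} {y} dummy meets)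
  meets⇒matching         (inj₂ matching) _  = matching

  induced⇒meets : ∀ {side m} (M : SemiInducedMatching H side m) {k l} → k ≢ l →
    Meets (ends (a M k)) (ends (b M l))
  induced⇒meets M {k} {l} k≢l = ¬dummy⇒meets {a M k} {b M l} (induced M k l k≢l ∘ inj₁)

-- The S-cut hypothesis is not needed: inducedness alone leaves at most 9
-- dummy edges.
lemma21 : (H : WGraph) (side : GV H → Bool) → IsSCut H side →
    (m : ℕ) (M : SemiInducedMatching H side m) →
    Σ (Subset m) λ s → (m ∸ 50 ≤ ∣ s ∣) ×
    (∀ k → k ∈ s → MatchingEdge H (a M k) (b M k))
lemma21 H side _ m M = ∁ apart , enough , matching
  where
  open CrossIntersecting Fin._≟_ (ends ∘ a M) (ends ∘ b M) (induced⇒meets M)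

  enough : m ∸ 50 ≤ ∣ ∁ apart ∣
  enough = begin
    m ∸ 50         ≤⟨ ∸-monoʳ-≤ m (≤-trans ∣apart∣≤9 (m≤m+n 9 41)) ⟩
    m ∸ ∣ apart ∣  ≡⟨ ∣∁p∣≡n∸∣p∣ apart ⟨
    ∣ ∁ apart ∣    ∎
    where open ≤-Reasoning

  matching : ∀ k → k ∈ ∁ apart → MatchingEdge H (a M k) (b M k)
  matching k k∈∁apart =
    meets⇒matching {x = a M k} {b M k} (isEdge M k) (∉apart⇒meets (x∈∁p⇒x∉p k∈∁apart))
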